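{- Let $\mathbb{G}$ be a graph, and let $G_1,\dots,G_T$ be subgraphs of $\mathbb{G}$ and $\rho_t\ge 1$ be such that $c^{max}(G_t)\le\rho_t\,c(G_t)$ for each $t=1,\dots,T$. Then: (i) $c^{max}\left(\bigcup_{t=1}^T G_t\right)\le T\cdot\max_{t}\rho_t\; c\left(\bigcup_{t=1}^T G_t\right)$; and (ii) if in addition $G_t\cap G_{t'}=\emptyset$ for each $t\neq t'\in[T]$, then $c^{max}\left(\bigcup_{t=1}^T G_t\right)\le\max_{t}\rho_t\; c\left(\bigcup_{t=1}^T G_t\right)$.
   Context: Let $(\mathcal{M},d)$ be a metric space and attach to each vertex $i$ of $\mathbb{G}$ a finite nonempty set $\mathcal{U}_i\subseteq\mathcal{M}$. For a subgraph $G$, with $\mathcal{U}=\prod_i\mathcal{U}_i$, $c(G)=\max_{u\in\mathcal{U}}\sum_{\{i,j\}\in E[G]}d(u_i,u_j)$, $d^{max}_{ij}=\max_{u_i\in\mathcal{U}_i,u_j\in\mathcal{U}_j}d(u_i,u_j)$, and $c^{max}(G)=\sum_{\{i,j\}\in E[G]}d^{max}_{ij}$. $G_t\cap G_{t'}=\emptyset$ means the subgraphs share no vertex. -}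

module Defs where

open import Level using (Level; _⊔_) renaming (suc to lsuc)
open import Algebra.Bundles using (CommutativeRing)
open import Relation.Binary.Core using (Rel)
open import Relation.Binary.Structures using (IsTotalOrder)
open import Relation.Nullary using (¬_)
open import Relation.Binary.PropositionalEquality using (_≡_; refl; cong₂)
open import Data.Product using (∃)
open import Data.Sum using (inj₁; inj₂)
open import Data.Empty using (⊥)
open import Data.Bool using (Bool; true; false; _∨_; _∧_; if_then_else_)
open import Data.Nat using (ℕ; zero; suc; _<ᵇ_)
open import Data.Fin using (Fin; zero; suc; toℕ)
open import Data.List.NonEmpty using (List⁺; _∷_; [_]; foldr₁; concatMap)
import Data.List.NonEmpty as L⁺
open import Function using (_∘_)

record OrderedField (c ℓ₁ ℓ₂ : Level) : Set (lsuc (c ⊔ ℓ₁ ⊔ ℓ₂)) where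
  field
    commutativeRing : CommutativeRing c ℓ₁
  open CommutativeRing commutativeRing public
  infix 4 _≤_
  field
    _≤_ : Rel Carrier ℓ₂
    isTotalOrder : IsTotalOrder _≈_ _≤_
    +-monoˡ-≤ : ∀ {x y} z → x ≤ y → x + z ≤ y + z
    *-nonneg : ∀ {x y} → 0# ≤ x → 0# ≤ y → 0# ≤ x * y
    0≉1 : ¬ (0# ≈ 1#)
    inverse : ∀ x → ¬ (x ≈ 0#) → ∃ λ y → x * y ≈ 1#
  open IsTotalOrder isTotalOrder public using (total)

record Graph : Set where
  field
    n : ℕ
    Adj : Fin n → Fin n → Bool
    adj-sym : ∀ i j → Adj i j ≡ Adj j i
    adj-irrefl : ∀ i → Adj i i ≡ false

module _ (𝔾 : Graph) where
  open Graph 𝔾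

  record Subgraph : Set where
    field
      V : Fin n → Bool
      E : Fin n → Fin n → Bool
      E-sym : ∀ i j → E i j ≡ E j i
      E⊆Adj : ∀ i j → E i j ≡ true → Adj i j ≡ true
      E-ends : ∀ i j → E i j ≡ true → V i ≡ true

  ∅G : Subgraph
  ∅G = record
    { V = λ _ → false ; E = λ _ _ → false ; E-sym = λ _ _ → refl
    ; E⊆Adj = λ _ _ () ; E-ends = λ _ _ () }

  _∪G_ : Subgraph → Subgraph → Subgraph
  G ∪G H = record
    { V = λ i → G.V i ∨ H.V i
    ; E = λ i j → G.E i j ∨ H.E i j
    ; E-sym = λ i j → cong₂ _∨_ (G.E-sym i j) (H.E-sym i j)
    ; E⊆Adj = sub
    ; E-ends = ends }
    where
      module G = Subgraph G
      module H = Subgraph H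
      sub : ∀ i j → (G.E i j ∨ H.E i j) ≡ true → Adj i j ≡ true
      sub i j p with G.E i j in eg
      ... | true = G.E⊆Adj i j eg
      ... | false = H.E⊆Adj i j p
      ends : ∀ i j → (G.E i j ∨ H.E i j) ≡ true → (G.V i ∨ H.V i) ≡ true
      ends i j p with G.E i j in eg
      ... | true rewrite G.E-ends i j eg = refl
      ... | false rewrite H.E-ends i j p with G.V i
      ...   | true = refl
      ...   | false = refl

  ⋃ : (T : ℕ) → (Fin T → Subgraph) → Subgraph
  ⋃ zero G = ∅G
  ⋃ (suc T) G = G zero ∪G ⋃ T (G ∘ suc)

  VertexDisjoint : Subgraph → Subgraph → Set
  VertexDisjoint G H = ∀ i → Subgraph.V G i ≡ true → Subgraph.V H i ≡ true → ⊥

consF : ∀ {a} {A : Set a} {k} → A → (Fin k → A) → Fin (suc k) → A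
consF x f zero = x
consF x f (suc i) = f i

assignments : ∀ {a} {A : Set a} (k : ℕ) → (Fin k → List⁺ A) → List⁺ (Fin k → A)
assignments zero U = [ (λ ()) ]
assignments (suc k) U =
  concatMap (λ x → L⁺.map (consF x) (assignments k (U ∘ suc))) (U zero)

module _ {c ℓ₁ ℓ₂} (F : OrderedField c ℓ₁ ℓ₂) where
  open OrderedField F using (Carrier; _≈_; _≤_; _+_; _*_; 0#; 1#; total)

  max : Carrier → Carrier → Carrier
  max x y with total x y
  ... | inj₁ _ = y
  ... | inj₂ _ = x

  max⁺ : List⁺ Carrier → Carrier
  max⁺ = foldr₁ max

  maxFin : (k : ℕ) → (Fin (suc k) → Carrier) → Carrier
  maxFin zero f = f zero
  maxFin (suc k) f = max (f zero) (maxFin k (f ∘ suc))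

  sumFin : (k : ℕ) → (Fin k → Carrier) → Carrier
  sumFin zero f = 0#
  sumFin (suc k) f = f zero + sumFin k (f ∘ suc)

  ι : ℕ → Carrier
  ι zero = 0#
  ι (suc k) = 1# + ι k

  record MetricSpace (m : Level) : Set (lsuc m ⊔ c ⊔ ℓ₁ ⊔ ℓ₂) where
    field
      Point : Set m
      d : Point → Point → Carrier
      d-self : ∀ x → d x x ≈ 0#
      d-zero : ∀ x y → d x y ≈ 0# → x ≡ y
      d-sym : ∀ x y → d x y ≈ d y x
      d-triangle : ∀ x y z → d x z ≤ d x y + d y z

  module _ {m} (M : MetricSpace m) (𝔾 : Graph)
           (U : Fin (Graph.n 𝔾) → List⁺ (MetricSpace.Point M)) where
    open MetricSpace M
    open Graph 𝔾

    -- sum over unordered edges {i,j} ∈ E[G] (i < j) of w i j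
    edgeSum : Subgraph 𝔾 → (Fin n → Fin n → Carrier) → Carrier
    edgeSum G w = sumFin n λ i → sumFin n λ j →
      if Subgraph.E G i j ∧ (toℕ i <ᵇ toℕ j) then w i j else 0#

    cost : Subgraph 𝔾 → Carrier
    cost G = max⁺ (L⁺.map (λ u → edgeSum G (λ i j → d (u i) (u j)))
                          (assignments n U))

    dmax : Fin n → Fin n → Carrier
    dmax i j = max⁺ (concatMap (λ x → L⁺.map (λ y → d x y) (U j)) (U i))

    costMax : Subgraph 𝔾 → Carrier
    costMax G = edgeSum G dmax

{-# OPTIONS --safe #-}
module Submission where

-- Every edge of ⋃ G_t lies in some G_t and edge costs are nonnegative, so
-- c^max(⋃ G_t) ≤ Σ_t c^max(G_t) ≤ Σ_t ρ_t c(G_t), while c(G_t) ≤ c(⋃ G_t) for each t;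
-- this gives (i). If the G_t are vertex-disjoint, maximising assignments for the
-- individual G_t can be glued into a single assignment that agrees with each of
-- them on the vertices of its subgraph, so Σ_t c(G_t) ≤ c(⋃ G_t), which gives (ii).

open import Defs
open import Data.Nat using (ℕ; zero; suc; _<ᵇ_)
open import Data.Fin using (Fin; zero; suc; toℕ)
open import Data.Fin.Properties using (suc-injective)
open import Data.Bool using (Bool; true; false; _∨_; _∧_; if_then_else_)
open import Data.Bool.Properties using (∧-distribʳ-∨; ∨-zeroʳ)
open import Data.Empty using (⊥; ⊥-elim)
open import Data.Sum using (inj₁; inj₂; _⊎_)
open import Data.Product using (∃; _×_; _,_; proj₁; proj₂)
open import Data.List using ([]; _∷_)
open import Data.List.NonEmpty as List⁺ using (List⁺; _∷_; toList; head)
open import Data.List.NonEmpty.Properties using (toList->>=)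
open import Data.List.Membership.Propositional using (_∈_)
open import Data.List.Membership.Propositional.Properties using (∈-map⁺; ∈-map⁻; >>=-∈↔)
open import Data.List.Relation.Unary.Any using (here; there)
open import Function using (_∘_; Inverse)
open import Relation.Nullary using (¬_)
open import Relation.Binary.PropositionalEquality as ≡ using (_≡_; _≗_)
open import Relation.Binary.Bundles using (Poset)
open import Relation.Binary.Structures using (IsTotalOrder)
import Algebra.Properties.Ring as RingProperties
import Algebra.Properties.CommutativeSemigroup as CommutativeSemigroupProperties
import Relation.Binary.Reasoning.PartialOrder as PartialOrderReasoning

_∈⁺_ : ∀ {a} {A : Set a} → A → List⁺ A → Set a
x ∈⁺ xs = x ∈ toList xs

head∈⁺ : ∀ {a} {A : Set a} (xs : List⁺ A) → head xs ∈⁺ xs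
head∈⁺ (x ∷ xs) = here ≡.refl

∈⁺-map⁺ : ∀ {a b} {A : Set a} {B : Set b} (f : A → B) {xs x} → x ∈⁺ xs → f x ∈⁺ List⁺.map f xs
∈⁺-map⁺ f {_ ∷ _} = ∈-map⁺ f

∈⁺-map⁻ : ∀ {a b} {A : Set a} {B : Set b} (f : A → B) {xs y} →
  y ∈⁺ List⁺.map f xs → ∃ λ x → x ∈⁺ xs × y ≡ f x
∈⁺-map⁻ f {_ ∷ _} = ∈-map⁻ f

∈⁺-concatMap⁺ : ∀ {a} {A B : Set a} (f : A → List⁺ B) {xs x y} →
  x ∈⁺ xs → y ∈⁺ f x → y ∈⁺ List⁺.concatMap f xs
∈⁺-concatMap⁺ f {xs} {x} {y} x∈xs y∈fx =
  ≡.subst (y ∈_) (toList->>= f xs) (Inverse.to (>>=-∈↔ {f = toList ∘ f}) (x , x∈xs , y∈fx))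

∈⁺-concatMap⁻ : ∀ {a} {A B : Set a} (f : A → List⁺ B) {xs y} →
  y ∈⁺ List⁺.concatMap f xs → ∃ λ x → x ∈⁺ xs × y ∈⁺ f x
∈⁺-concatMap⁻ f {xs} {y} y∈ =
  Inverse.from (>>=-∈↔ {xs = toList xs} {f = toList ∘ f}) (≡.subst (y ∈_) (≡.sym (toList->>= f xs)) y∈)

∈-assignments⁻ : ∀ {a} {A : Set a} k (U : Fin k → List⁺ A) {u} →
  u ∈⁺ assignments k U → ∀ i → u i ∈⁺ U i
∈-assignments⁻ zero U _ ()
∈-assignments⁻ (suc k) U u∈ i with ∈⁺-concatMap⁻ _ {U zero} u∈
... | x , x∈ , u∈′ with ∈⁺-map⁻ (consF x) u∈′
... | v , v∈ , ≡.refl with i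
...   | zero = x∈
...   | suc i = ∈-assignments⁻ k (U ∘ suc) v∈ i

-- Only up to ≗: the list holds functions built by consF, and there is no function extensionality.
∈-assignments⁺ : ∀ {a} {A : Set a} k (U : Fin k → List⁺ A) {u} →
  (∀ i → u i ∈⁺ U i) → ∃ λ u′ → u′ ∈⁺ assignments k U × u′ ≗ u
∈-assignments⁺ zero U u∈ = (λ ()) , here ≡.refl , λ ()
∈-assignments⁺ (suc k) U {u} u∈ with ∈-assignments⁺ k (U ∘ suc) (u∈ ∘ suc)
... | v , v∈ , v≗ =
  consF (u zero) v ,
  ∈⁺-concatMap⁺ _ (u∈ zero) (∈⁺-map⁺ (consF (u zero)) v∈) ,
  λ { zero → ≡.refl ; (suc i) → v≗ i }

∧-monoˡ-true : ∀ {a b} l → (a ≡ true → b ≡ true) → a ∧ l ≡ true → b ∧ l ≡ true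
∧-monoˡ-true {true} l a⇒b al rewrite a⇒b ≡.refl = al
∧-monoˡ-true {false} l a⇒b ()

∧-disjointˡ-true : ∀ {a b} l → (a ≡ true → b ≡ true → ⊥) → a ∧ l ≡ true → b ∧ l ≡ true → ⊥
∧-disjointˡ-true {true} {true} l a⊥b _ _ = a⊥b ≡.refl ≡.refl
∧-disjointˡ-true {true} {false} l a⊥b _ ()
∧-disjointˡ-true {false} l a⊥b ()

module OrderedFieldProperties {a ℓ₁ ℓ₂} (F : OrderedField a ℓ₁ ℓ₂) where
  open OrderedField F hiding (zero)
  open RingProperties ring using (-1*x≈-x; -‿involutive)
  open CommutativeSemigroupProperties +-commutativeSemigroup using (interchange)

  poset : Poset a ℓ₁ ℓ₂
  poset = record { isPartialOrder = IsTotalOrder.isPartialOrder isTotalOrder }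

  open Poset poset public using ()
    renaming (refl to ≤-refl; reflexive to ≤-reflexive; trans to ≤-trans)
  module ≤-Reasoning = PartialOrderReasoning poset
  open ≤-Reasoning

  +-mono-≤ : ∀ {x y u v} → x ≤ y → u ≤ v → x + u ≤ y + v
  +-mono-≤ {x} {y} {u} {v} x≤y u≤v = begin
    x + u  ≤⟨ +-monoˡ-≤ u x≤y ⟩
    y + u  ≈⟨ +-comm y u ⟩
    u + y  ≤⟨ +-monoˡ-≤ y u≤v ⟩
    v + y  ≈⟨ +-comm v y ⟩
    y + v  ∎

  x≤y⇒0≤y-x : ∀ {x y} → x ≤ y → 0# ≤ y - x
  x≤y⇒0≤y-x {x} {y} x≤y = begin
    0#     ≈⟨ sym (-‿inverseʳ x) ⟩
    x - x  ≤⟨ +-monoˡ-≤ (- x) x≤y ⟩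
    y - x  ∎

  0≤1 : 0# ≤ 1#
  0≤1 with total 0# 1#
  ... | inj₁ 0≤1 = 0≤1
  ... | inj₂ 1≤0 = begin
    0#           ≤⟨ *-nonneg 0≤-1 0≤-1 ⟩
    - 1# * - 1#  ≈⟨ -1*x≈-x (- 1#) ⟩
    - (- 1#)     ≈⟨ -‿involutive 1# ⟩
    1#           ∎
    where
    0≤-1 : 0# ≤ - 1#
    0≤-1 = ≤-trans (x≤y⇒0≤y-x 1≤0) (≤-reflexive (+-identityˡ (- 1#)))

  *-monoˡ-≤-nonNeg : ∀ {z x y} → 0# ≤ z → x ≤ y → z * x ≤ z * y
  *-monoˡ-≤-nonNeg {z} {x} {y} 0≤z x≤y = begin
    z * x                ≈⟨ sym (+-identityˡ (z * x)) ⟩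
    0# + z * x           ≤⟨ +-monoˡ-≤ (z * x) (*-nonneg 0≤z (x≤y⇒0≤y-x x≤y)) ⟩
    z * (y - x) + z * x  ≈⟨ sym (distribˡ z (y - x) x) ⟩
    z * (y - x + x)      ≈⟨ *-congˡ y-x+x≈y ⟩
    z * y                ∎
    where
    y-x+x≈y : y - x + x ≈ y
    y-x+x≈y = trans (+-assoc y (- x) x) (trans (+-congˡ (-‿inverseˡ x)) (+-identityʳ y))

  *-monoʳ-≤-nonNeg : ∀ {z x y} → 0# ≤ z → x ≤ y → x * z ≤ y * z
  *-monoʳ-≤-nonNeg {z} {x} {y} 0≤z x≤y = begin
    x * z  ≈⟨ *-comm x z ⟩
    z * x  ≤⟨ *-monoˡ-≤-nonNeg 0≤z x≤y ⟩
    z * y  ≈⟨ *-comm z y ⟩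
    y * z  ∎

  0≤x+x⇒0≤x : ∀ {x} → 0# ≤ x + x → 0# ≤ x
  0≤x+x⇒0≤x {x} 0≤x+x with total 0# x
  ... | inj₁ 0≤x = 0≤x
  ... | inj₂ x≤0 = begin
    0#      ≤⟨ 0≤x+x ⟩
    x + x   ≤⟨ +-monoˡ-≤ x x≤0 ⟩
    0# + x  ≈⟨ +-identityˡ x ⟩
    x       ∎

  x≤max[x,y] : ∀ x y → x ≤ max F x y
  x≤max[x,y] x y with total x y
  ... | inj₁ x≤y = x≤y
  ... | inj₂ _ = ≤-refl

  y≤max[x,y] : ∀ x y → y ≤ max F x y
  y≤max[x,y] x y with total x y
  ... | inj₁ _ = ≤-refl
  ... | inj₂ y≤x = y≤x

  max-sel : ∀ x y → max F x y ≡ x ⊎ max F x y ≡ y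
  max-sel x y with total x y
  ... | inj₁ _ = inj₂ ≡.refl
  ... | inj₂ _ = inj₁ ≡.refl

  f≤maxFin : ∀ k (f : Fin (suc k) → Carrier) t → f t ≤ maxFin F k f
  f≤maxFin zero f zero = ≤-refl
  f≤maxFin (suc k) f zero = x≤max[x,y] _ _
  f≤maxFin (suc k) f (suc t) = ≤-trans (f≤maxFin k (f ∘ suc) t) (y≤max[x,y] _ _)

  ∈⇒≤max⁺ : ∀ xs {y} → y ∈⁺ xs → y ≤ max⁺ F xs
  ∈⇒≤max⁺ (x ∷ []) (here ≡.refl) = ≤-refl
  ∈⇒≤max⁺ (x ∷ y ∷ ys) (here ≡.refl) = x≤max[x,y] _ _
  ∈⇒≤max⁺ (x ∷ y ∷ ys) (there y∈) = ≤-trans (∈⇒≤max⁺ (y ∷ ys) y∈) (y≤max[x,y] _ _)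

  max⁺∈ : ∀ xs → max⁺ F xs ∈⁺ xs
  max⁺∈ (x ∷ xs) = go x xs
    where
    go : ∀ x xs → max⁺ F (x ∷ xs) ∈⁺ (x ∷ xs)
    go x [] = here ≡.refl
    go x (y ∷ ys) with go y ys | max-sel x (max⁺ F (y ∷ ys))
    ... | _ | inj₁ ≡x = here ≡x
    ... | max∈ | inj₂ ≡max = there (≡.subst (_∈⁺ (y ∷ ys)) (≡.sym ≡max) max∈)

  sumFin-cong : ∀ k {f g : Fin k → Carrier} → (∀ i → f i ≈ g i) → sumFin F k f ≈ sumFin F k g
  sumFin-cong zero f≈g = refl
  sumFin-cong (suc k) f≈g = +-cong (f≈g zero) (sumFin-cong k (f≈g ∘ suc))

  sumFin-mono-≤ : ∀ k {f g : Fin k → Carrier} → (∀ i → f i ≤ g i) → sumFin F k f ≤ sumFin F k g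
  sumFin-mono-≤ zero f≤g = ≤-refl
  sumFin-mono-≤ (suc k) f≤g = +-mono-≤ (f≤g zero) (sumFin-mono-≤ k (f≤g ∘ suc))

  sumFin-nonNeg : ∀ k {f : Fin k → Carrier} → (∀ i → 0# ≤ f i) → 0# ≤ sumFin F k f
  sumFin-nonNeg zero 0≤f = ≤-refl
  sumFin-nonNeg (suc k) 0≤f =
    ≤-trans (≤-reflexive (sym (+-identityˡ 0#))) (+-mono-≤ (0≤f zero) (sumFin-nonNeg k (0≤f ∘ suc)))

  sumFin-zero : ∀ k → sumFin F k (λ _ → 0#) ≈ 0#
  sumFin-zero zero = refl
  sumFin-zero (suc k) = trans (+-identityˡ _) (sumFin-zero k)

  sumFin-+ : ∀ k (f g : Fin k → Carrier) →
    sumFin F k (λ i → f i + g i) ≈ sumFin F k f + sumFin F k g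
  sumFin-+ zero f g = sym (+-identityˡ 0#)
  sumFin-+ (suc k) f g =
    trans (+-congˡ (sumFin-+ k (f ∘ suc) (g ∘ suc))) (interchange _ _ _ _)

  sumFin-*ˡ : ∀ k z (f : Fin k → Carrier) → sumFin F k (λ i → z * f i) ≈ z * sumFin F k f
  sumFin-*ˡ zero z f = sym (zeroʳ z)
  sumFin-*ˡ (suc k) z f = trans (+-congˡ (sumFin-*ˡ k z (f ∘ suc))) (sym (distribˡ z _ _))

  sumFin-const : ∀ k z → sumFin F k (λ _ → z) ≈ ι F k * z
  sumFin-const zero z = sym (zeroˡ z)
  sumFin-const (suc k) z = begin-equality
    z + sumFin F k (λ _ → z)  ≈⟨ +-cong (sym (*-identityˡ z)) (sumFin-const k z) ⟩
    1# * z + ι F k * z        ≈⟨ sym (distribʳ z 1# (ι F k)) ⟩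
    (1# + ι F k) * z          ∎

  if-nonNeg : ∀ b {x} → 0# ≤ x → 0# ≤ (if b then x else 0#)
  if-nonNeg true 0≤x = 0≤x
  if-nonNeg false _ = ≤-refl

  if-∨-≤ : ∀ b b′ {x} → 0# ≤ x →
    (if b ∨ b′ then x else 0#) ≤ (if b then x else 0#) + (if b′ then x else 0#)
  if-∨-≤ true true {x} 0≤x = ≤-trans (≤-reflexive (sym (+-identityʳ x))) (+-mono-≤ ≤-refl 0≤x)
  if-∨-≤ true false {x} _ = ≤-reflexive (sym (+-identityʳ x))
  if-∨-≤ false b′ _ = ≤-reflexive (sym (+-identityˡ _))

  if-∨-≈ : ∀ b b′ {x} → (b ≡ true → b′ ≡ true → ⊥) →
    (if b ∨ b′ then x else 0#) ≈ (if b then x else 0#) + (if b′ then x else 0#)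
  if-∨-≈ true true b⊥b′ = ⊥-elim (b⊥b′ ≡.refl ≡.refl)
  if-∨-≈ true false {x} _ = sym (+-identityʳ x)
  if-∨-≈ false b′ _ = sym (+-identityˡ _)

  if-mono : ∀ b b′ {x} → (b ≡ true → b′ ≡ true) → 0# ≤ x →
    (if b then x else 0#) ≤ (if b′ then x else 0#)
  if-mono true true _ _ = ≤-refl
  if-mono true false b⇒b′ _ with b⇒b′ ≡.refl
  ... | ()
  if-mono false true _ 0≤x = 0≤x
  if-mono false false _ _ = ≤-refl

  if-cong : ∀ b {x y} → (b ≡ true → x ≈ y) → (if b then x else 0#) ≈ (if b then y else 0#)
  if-cong true x≈y = x≈y ≡.refl
  if-cong false _ = refl

  maskedSum : ∀ n → (Fin n → Fin n → Bool) → (Fin n → Fin n → Carrier) → Carrier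
  maskedSum n b w = sumFin F n λ i → sumFin F n λ j → if b i j then w i j else 0#

  module _ {n : ℕ} where
    NonNeg : (Fin n → Fin n → Carrier) → Set ℓ₂
    NonNeg w = ∀ i j → 0# ≤ w i j

    sumFin²-+ : ∀ (f g : Fin n → Fin n → Carrier) →
      sumFin F n (λ i → sumFin F n λ j → f i j + g i j)
        ≈ sumFin F n (λ i → sumFin F n (f i)) + sumFin F n (λ i → sumFin F n (g i))
    sumFin²-+ f g = trans (sumFin-cong n λ i → sumFin-+ n (f i) (g i)) (sumFin-+ n _ _)

    maskedSum-nonNeg : ∀ b {w} → NonNeg w → 0# ≤ maskedSum n b w
    maskedSum-nonNeg b 0≤w = sumFin-nonNeg n λ i → sumFin-nonNeg n λ j → if-nonNeg (b i j) (0≤w i j)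

    maskedSum-∨-≤ : ∀ b b′ {w} → NonNeg w →
      maskedSum n (λ i j → b i j ∨ b′ i j) w ≤ maskedSum n b w + maskedSum n b′ w
    maskedSum-∨-≤ b b′ 0≤w = ≤-trans
      (sumFin-mono-≤ n λ i → sumFin-mono-≤ n λ j → if-∨-≤ (b i j) (b′ i j) (0≤w i j))
      (≤-reflexive (sumFin²-+ _ _))

    maskedSum-∨-≈ : ∀ b b′ w → (∀ i j → b i j ≡ true → b′ i j ≡ true → ⊥) →
      maskedSum n (λ i j → b i j ∨ b′ i j) w ≈ maskedSum n b w + maskedSum n b′ w
    maskedSum-∨-≈ b b′ w b⊥b′ = trans
      (sumFin-cong n λ i → sumFin-cong n λ j → if-∨-≈ (b i j) (b′ i j) (b⊥b′ i j))
      (sumFin²-+ _ _)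

    maskedSum-mono : ∀ b b′ {w} → (∀ i j → b i j ≡ true → b′ i j ≡ true) → NonNeg w →
      maskedSum n b w ≤ maskedSum n b′ w
    maskedSum-mono b b′ b⇒b′ 0≤w =
      sumFin-mono-≤ n λ i → sumFin-mono-≤ n λ j → if-mono (b i j) (b′ i j) (b⇒b′ i j) (0≤w i j)

    maskedSum-cong : ∀ b {w w′} → (∀ i j → b i j ≡ true → w i j ≈ w′ i j) →
      maskedSum n b w ≈ maskedSum n b w′
    maskedSum-cong b w≈w′ = sumFin-cong n λ i → sumFin-cong n λ j → if-cong (b i j) (w≈w′ i j)

    maskedSum-cong-mask : ∀ {b b′} w → (∀ i j → b i j ≡ b′ i j) → maskedSum n b w ≈ maskedSum n b′ w
    maskedSum-cong-mask w b≡b′ =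
      sumFin-cong n λ i → sumFin-cong n λ j → reflexive (≡.cong (λ β → if β then w i j else 0#) (b≡b′ i j))

    maskedSum-false : ∀ w → maskedSum n (λ _ _ → false) w ≈ 0#
    maskedSum-false w = trans (sumFin-cong n λ _ → sumFin-zero n) (sumFin-zero n)

module CostProperties {a ℓ₁ ℓ₂ m} (F : OrderedField a ℓ₁ ℓ₂) (M : MetricSpace F m) (𝔾 : Graph)
         (U : Fin (Graph.n 𝔾) → List⁺ (MetricSpace.Point M)) where
  open OrderedField F hiding (zero)
  open OrderedFieldProperties F
  open ≤-Reasoning
  open MetricSpace M
  open Graph 𝔾
  open Subgraph

  d-nonNeg : ∀ x y → 0# ≤ d x y
  d-nonNeg x y = 0≤x+x⇒0≤x (begin
    0#             ≈⟨ sym (d-self x) ⟩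
    d x x          ≤⟨ d-triangle x y x ⟩
    d x y + d y x  ≈⟨ +-congˡ (d-sym y x) ⟩
    d x y + d x y  ∎)

  Σᴱ : Subgraph 𝔾 → (Fin n → Fin n → Carrier) → Carrier
  Σᴱ = edgeSum F M 𝔾 U

  c[_] : Subgraph 𝔾 → Carrier
  c[_] = cost F M 𝔾 U

  cᵐᵃˣ[_] : Subgraph 𝔾 → Carrier
  cᵐᵃˣ[_] = costMax F M 𝔾 U

  _⊆ᴱ_ : Subgraph 𝔾 → Subgraph 𝔾 → Set
  A ⊆ᴱ B = ∀ i j → E A i j ≡ true → E B i j ≡ true

  EdgeDisjoint : Subgraph 𝔾 → Subgraph 𝔾 → Set
  EdgeDisjoint A B = ∀ i j → E A i j ≡ true → E B i j ≡ true → ⊥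

  PairwiseDisjoint : ∀ T → (Fin T → Subgraph 𝔾) → Set
  PairwiseDisjoint T G = ∀ t t′ → ¬ (t ≡ t′) → VertexDisjoint 𝔾 (G t) (G t′)

  pairwiseDisjoint-tail : ∀ {T G} → PairwiseDisjoint (suc T) G → PairwiseDisjoint T (G ∘ suc)
  pairwiseDisjoint-tail disj t t′ t≢t′ = disj (suc t) (suc t′) (t≢t′ ∘ suc-injective)

  vertexDisjoint⇒edgeDisjoint : ∀ {A B} → VertexDisjoint 𝔾 A B → EdgeDisjoint A B
  vertexDisjoint⇒edgeDisjoint {A} {B} disj i j ijA ijB = disj i (E-ends A i j ijA) (E-ends B i j ijB)

  -- edgeSum G w is definitionally maskedSum n (onEdge G) w.
  onEdge : Subgraph 𝔾 → Fin n → Fin n → Bool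
  onEdge G i j = E G i j ∧ (toℕ i <ᵇ toℕ j)

  edgeSum-nonNeg : ∀ G {w} → NonNeg w → 0# ≤ Σᴱ G w
  edgeSum-nonNeg G = maskedSum-nonNeg (onEdge G)

  edgeSum-∪-≤ : ∀ A B {w} → NonNeg w → Σᴱ (_∪G_ 𝔾 A B) w ≤ Σᴱ A w + Σᴱ B w
  edgeSum-∪-≤ A B {w} 0≤w = ≤-trans
    (≤-reflexive (maskedSum-cong-mask w λ i j → ∧-distribʳ-∨ (toℕ i <ᵇ toℕ j) (E A i j) (E B i j)))
    (maskedSum-∨-≤ (onEdge A) (onEdge B) 0≤w)

  edgeSum-∪-≈ : ∀ A B w → EdgeDisjoint A B → Σᴱ (_∪G_ 𝔾 A B) w ≈ Σᴱ A w + Σᴱ B w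
  edgeSum-∪-≈ A B w disj = trans
    (maskedSum-cong-mask w λ i j → ∧-distribʳ-∨ (toℕ i <ᵇ toℕ j) (E A i j) (E B i j))
    (maskedSum-∨-≈ (onEdge A) (onEdge B) w λ i j → ∧-disjointˡ-true (toℕ i <ᵇ toℕ j) (disj i j))

  edgeSum-mono : ∀ {A B w} → A ⊆ᴱ B → NonNeg w → Σᴱ A w ≤ Σᴱ B w
  edgeSum-mono {A} {B} A⊆B =
    maskedSum-mono (onEdge A) (onEdge B) λ i j → ∧-monoˡ-true (toℕ i <ᵇ toℕ j) (A⊆B i j)

  edgeSum-cong : ∀ G {w w′} → (∀ i j → E G i j ≡ true → w i j ≈ w′ i j) → Σᴱ G w ≈ Σᴱ G w′
  edgeSum-cong G w≈w′ = maskedSum-cong (onEdge G) λ i j ij∈ → w≈w′ i j (edge ij∈)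
    where
    edge : ∀ {b l} → b ∧ l ≡ true → b ≡ true
    edge {true} _ = ≡.refl
    edge {false} ()

  ⊆ᴱ-⋃ : ∀ T G t → G t ⊆ᴱ ⋃ 𝔾 T G
  ⊆ᴱ-⋃ zero G ()
  ⊆ᴱ-⋃ (suc T) G zero i j ij∈ rewrite ij∈ = ≡.refl
  ⊆ᴱ-⋃ (suc T) G (suc t) i j ij∈ rewrite ⊆ᴱ-⋃ T (G ∘ suc) t i j ij∈ = ∨-zeroʳ (E (G zero) i j)

  E-⋃⁻ : ∀ T G i j → E (⋃ 𝔾 T G) i j ≡ true → ∃ λ t → E (G t) i j ≡ true
  E-⋃⁻ zero G i j ()
  E-⋃⁻ (suc T) G i j ij∈ with E (G zero) i j in ij∈G₀
  ... | true = zero , ij∈G₀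
  ... | false with E-⋃⁻ T (G ∘ suc) i j ij∈
  ...   | t , ij∈Gₜ = suc t , ij∈Gₜ

  edgeSum-⋃-≤ : ∀ T G {w} → NonNeg w → Σᴱ (⋃ 𝔾 T G) w ≤ sumFin F T (λ t → Σᴱ (G t) w)
  edgeSum-⋃-≤ zero G {w} _ = ≤-reflexive (maskedSum-false w)
  edgeSum-⋃-≤ (suc T) G 0≤w = ≤-trans
    (edgeSum-∪-≤ (G zero) (⋃ 𝔾 T (G ∘ suc)) 0≤w)
    (+-mono-≤ ≤-refl (edgeSum-⋃-≤ T (G ∘ suc) 0≤w))

  edgeSum-⋃-≈ : ∀ T G w → PairwiseDisjoint T G → Σᴱ (⋃ 𝔾 T G) w ≈ sumFin F T (λ t → Σᴱ (G t) w)
  edgeSum-⋃-≈ zero G w _ = maskedSum-false w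
  edgeSum-⋃-≈ (suc T) G w disj = trans
    (edgeSum-∪-≈ (G zero) (⋃ 𝔾 T (G ∘ suc)) w G₀⊥rest)
    (+-congˡ (edgeSum-⋃-≈ T (G ∘ suc) w (pairwiseDisjoint-tail {G = G} disj)))
    where
    G₀⊥rest : EdgeDisjoint (G zero) (⋃ 𝔾 T (G ∘ suc))
    G₀⊥rest i j ij∈G₀ ij∈rest with E-⋃⁻ T (G ∘ suc) i j ij∈rest
    ... | t , ij∈Gₜ = vertexDisjoint⇒edgeDisjoint {G zero} {G (suc t)} (disj zero (suc t) λ ()) i j ij∈G₀ ij∈Gₜ

  dist : (Fin n → Point) → Fin n → Fin n → Carrier
  dist u i j = d (u i) (u j)

  dist-nonNeg : ∀ u → NonNeg (dist u)
  dist-nonNeg u i j = d-nonNeg (u i) (u j)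

  dmax-nonNeg : NonNeg (dmax F M 𝔾 U)
  dmax-nonNeg i j = distances-nonNeg (U i) (U j)
    where
    distances-nonNeg : ∀ xs ys → 0# ≤ max⁺ F (List⁺.concatMap (λ x → List⁺.map (d x) ys) xs)
    distances-nonNeg xs@(x ∷ _) ys@(y ∷ _) =
      ≤-trans (d-nonNeg x y) (∈⇒≤max⁺ (List⁺.concatMap (λ x → List⁺.map (d x) ys) xs) (here ≡.refl))

  _∈𝒰 : (Fin n → Point) → Set m
  u ∈𝒰 = ∀ i → u i ∈⁺ U i

  edgeSum≤cost : ∀ G {u} → u ∈𝒰 → Σᴱ G (dist u) ≤ c[ G ]
  edgeSum≤cost G {u} u∈𝒰 with ∈-assignments⁺ n U u∈𝒰
  ... | u′ , u′∈ , u′≗u = begin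
    Σᴱ G (dist u)   ≈⟨ edgeSum-cong G (λ i j _ → reflexive (≡.cong₂ d (≡.sym (u′≗u i)) (≡.sym (u′≗u j)))) ⟩
    Σᴱ G (dist u′)  ≤⟨ ∈⇒≤max⁺ _ (∈⁺-map⁺ (Σᴱ G ∘ dist) u′∈) ⟩
    c[ G ]          ∎

  cost-attained : ∀ G → ∃ λ u → u ∈𝒰 × c[ G ] ≡ Σᴱ G (dist u)
  cost-attained G with ∈⁺-map⁻ (Σᴱ G ∘ dist) (max⁺∈ _)
  ... | u , u∈ , ≡Σ = u , ∈-assignments⁻ n U u∈ , ≡Σ

  cost-nonNeg : ∀ G → 0# ≤ c[ G ]
  cost-nonNeg G = ≤-trans (edgeSum-nonNeg G (dist-nonNeg heads)) (edgeSum≤cost G (head∈⁺ ∘ U))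
    where
    heads : Fin n → Point
    heads i = head (U i)

  cost-mono : ∀ {A B} → A ⊆ᴱ B → c[ A ] ≤ c[ B ]
  cost-mono {A} {B} A⊆B with cost-attained A
  ... | u , u∈𝒰 , ≡Σ = begin
    c[ A ]         ≡⟨ ≡Σ ⟩
    Σᴱ A (dist u)  ≤⟨ edgeSum-mono {A} {B} A⊆B (dist-nonNeg u) ⟩
    Σᴱ B (dist u)  ≤⟨ edgeSum≤cost B u∈𝒰 ⟩
    c[ B ]         ∎

  glue : ∀ T → (Fin T → Subgraph 𝔾) → (Fin T → Fin n → Point) → Fin n → Point
  glue zero G us i = head (U i)
  glue (suc T) G us i = if V (G zero) i then us zero i else glue T (G ∘ suc) (us ∘ suc) i

  glue-agrees : ∀ T G us → PairwiseDisjoint T G → ∀ t i → V (G t) i ≡ true → glue T G us i ≡ us t i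
  glue-agrees zero G us _ ()
  glue-agrees (suc T) G us disj zero i i∈ rewrite i∈ = ≡.refl
  glue-agrees (suc T) G us disj (suc t) i i∈ with V (G zero) i in i∈G₀
  ... | true = ⊥-elim (disj zero (suc t) (λ ()) i i∈G₀ i∈)
  ... | false = glue-agrees T (G ∘ suc) (us ∘ suc) (pairwiseDisjoint-tail {G = G} disj) t i i∈

  glue-∈𝒰 : ∀ T G us → (∀ t → us t ∈𝒰) → glue T G us ∈𝒰
  glue-∈𝒰 zero G us _ i = head∈⁺ (U i)
  glue-∈𝒰 (suc T) G us us∈𝒰 i with V (G zero) i
  ... | true = us∈𝒰 zero i
  ... | false = glue-∈𝒰 T (G ∘ suc) (us ∘ suc) (us∈𝒰 ∘ suc) i

  sumFin-cost≤cost-⋃ : ∀ T G → PairwiseDisjoint T G → sumFin F T (λ t → c[ G t ]) ≤ c[ ⋃ 𝔾 T G ]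
  sumFin-cost≤cost-⋃ T G disj = begin
    sumFin F T (λ t → c[ G t ])                ≈⟨ sumFin-cong T (reflexive ∘ cost≡Σ) ⟩
    sumFin F T (λ t → Σᴱ (G t) (dist (us t)))  ≈⟨ sumFin-cong T (λ t → edgeSum-cong (G t) (glued-agrees t)) ⟩
    sumFin F T (λ t → Σᴱ (G t) (dist glued))   ≈⟨ sym (edgeSum-⋃-≈ T G (dist glued) disj) ⟩
    Σᴱ (⋃ 𝔾 T G) (dist glued)                  ≤⟨ edgeSum≤cost (⋃ 𝔾 T G) (glue-∈𝒰 T G us us∈𝒰) ⟩
    c[ ⋃ 𝔾 T G ]                               ∎
    where
    us : Fin T → Fin n → Point
    us t = proj₁ (cost-attained (G t))
    us∈𝒰 : ∀ t → us t ∈𝒰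
    us∈𝒰 t = proj₁ (proj₂ (cost-attained (G t)))
    cost≡Σ : ∀ t → c[ G t ] ≡ Σᴱ (G t) (dist (us t))
    cost≡Σ t = proj₂ (proj₂ (cost-attained (G t)))
    glued : Fin n → Point
    glued = glue T G us
    glued-agrees : ∀ t i j → E (G t) i j ≡ true → dist (us t) i j ≈ dist glued i j
    glued-agrees t i j ij∈ = reflexive (≡.cong₂ d
      (≡.sym (glue-agrees T G us disj t i (E-ends (G t) i j ij∈)))
      (≡.sym (glue-agrees T G us disj t j (E-ends (G t) j i (≡.trans (E-sym (G t) j i) ij∈)))))

proposition1 : ∀ {c ℓ₁ ℓ₂ m} (F : OrderedField c ℓ₁ ℓ₂) →
    let open OrderedField F in
    (M : MetricSpace F m) (𝔾 : Graph) →
    (U : Fin (Graph.n 𝔾) → List⁺ (MetricSpace.Point M)) →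
    (k : ℕ) (G : Fin (suc k) → Subgraph 𝔾) (ρ : Fin (suc k) → Carrier) →
    (∀ t → 1# ≤ ρ t) →
    (∀ t → costMax F M 𝔾 U (G t) ≤ ρ t * cost F M 𝔾 U (G t)) →
    (costMax F M 𝔾 U (⋃ 𝔾 (suc k) G)
       ≤ (ι F (suc k) * maxFin F k ρ) * cost F M 𝔾 U (⋃ 𝔾 (suc k) G))
    × ((∀ t t′ → ¬ (t ≡ t′) → VertexDisjoint 𝔾 (G t) (G t′)) →
       costMax F M 𝔾 U (⋃ 𝔾 (suc k) G)
         ≤ maxFin F k ρ * cost F M 𝔾 U (⋃ 𝔾 (suc k) G))
proposition1 F M 𝔾 U k G ρ 1≤ρ cᵐᵃˣ≤ρc = bound , disjointBound
  where
  open OrderedField F hiding (zero)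
  open OrderedFieldProperties F
  open ≤-Reasoning
  open CostProperties F M 𝔾 U
  T : ℕ
  T = suc k
  ρ* : Carrier
  ρ* = maxFin F k ρ
  ⋃G : Subgraph 𝔾
  ⋃G = ⋃ 𝔾 T G

  0≤ρ : ∀ t → 0# ≤ ρ t
  0≤ρ t = ≤-trans 0≤1 (1≤ρ t)

  ρ≤ρ* : ∀ t → ρ t ≤ ρ*
  ρ≤ρ* = f≤maxFin k ρ

  cᵐᵃˣ[⋃G]≤Σρc : cᵐᵃˣ[ ⋃G ] ≤ sumFin F T (λ t → ρ t * c[ G t ])
  cᵐᵃˣ[⋃G]≤Σρc = ≤-trans (edgeSum-⋃-≤ T G dmax-nonNeg) (sumFin-mono-≤ T cᵐᵃˣ≤ρc)

  bound : cᵐᵃˣ[ ⋃G ] ≤ ι F T * ρ* * c[ ⋃G ]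
  bound = begin
    cᵐᵃˣ[ ⋃G ]                          ≤⟨ cᵐᵃˣ[⋃G]≤Σρc ⟩
    sumFin F T (λ t → ρ t * c[ G t ])  ≤⟨ sumFin-mono-≤ T (λ t → ≤-trans
                                             (*-monoˡ-≤-nonNeg (0≤ρ t) (cost-mono {G t} {⋃G} (⊆ᴱ-⋃ T G t)))
                                             (*-monoʳ-≤-nonNeg (cost-nonNeg ⋃G) (ρ≤ρ* t))) ⟩
    sumFin F T (λ _ → ρ* * c[ ⋃G ])    ≈⟨ sumFin-const T (ρ* * c[ ⋃G ]) ⟩
    ι F T * (ρ* * c[ ⋃G ])             ≈⟨ sym (*-assoc (ι F T) ρ* c[ ⋃G ]) ⟩
    ι F T * ρ* * c[ ⋃G ]               ∎

  disjointBound : PairwiseDisjoint T G → cᵐᵃˣ[ ⋃G ] ≤ ρ* * c[ ⋃G ]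
  disjointBound disj = begin
    cᵐᵃˣ[ ⋃G ]                          ≤⟨ cᵐᵃˣ[⋃G]≤Σρc ⟩
    sumFin F T (λ t → ρ t * c[ G t ])  ≤⟨ sumFin-mono-≤ T (λ t → *-monoʳ-≤-nonNeg (cost-nonNeg (G t)) (ρ≤ρ* t)) ⟩
    sumFin F T (λ t → ρ* * c[ G t ])   ≈⟨ sumFin-*ˡ T ρ* (λ t → c[ G t ]) ⟩
    ρ* * sumFin F T (λ t → c[ G t ])   ≤⟨ *-monoˡ-≤-nonNeg (≤-trans (0≤ρ zero) (ρ≤ρ* zero)) (sumFin-cost≤cost-⋃ T G disj) ⟩
    ρ* * c[ ⋃G ]                       ∎
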